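{- The number of distinct maximum genus embeddings of the complete graph $K_5$ is at least $432$.
   Context: Embeddings are orientable cellular embeddings of the labeled graph, identified with rotation systems (a cyclic order of the incident edges at each vertex); two embeddings are distinct if their rotation systems differ. A maximum genus embedding is one in an orientable surface of genus equal to the maximum genus of the graph. -}

module Defs where

open import Data.Nat using (ℕ; zero; suc; _+_; _*_; _∸_; _≤ᵇ_; _/_; _≤_)
open import Data.Bool using (Bool; true; false; _∧_; not)
open import Data.Fin using (Fin; toℕ; _≟_)
open import Data.List using (List; []; _∷_; length; filter; allFin; cartesianProduct; upTo)
open import Data.List.Relation.Unary.All using (All)
open import Data.List.Relation.Unary.AllPairs using (AllPairs)
open import Data.Product using (_×_; _,_; ∃-syntax)
open import Relation.Nullary using (¬_; does)
open import Relation.Nullary.Decidable using (T?)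
open import Data.Bool using (T)
open import Relation.Binary.PropositionalEquality using (_≡_; _≢_)

-- The complete graph K5: vertex set Fin 5, every pair of distinct vertices adjacent.
V : Set
V = Fin 5

nV nE : ℕ
nV = 5
nE = 10

iter : {A : Set} → (A → A) → ℕ → A → A
iter f zero    x = x
iter f (suc k) x = f (iter f k x)

-- A rotation system assigns to every vertex v a cyclic order of its neighbours,
-- encoded as the successor map ρ v : V → V on the neighbours of v
-- (ρ v w = the neighbour following w in the cyclic order at v).
-- The value at v itself is normalised to ρ v v = v, so rotation systems
-- correspond bijectively to such maps.
Rot : Set
Rot = V → V → V

IsRotationSystem : Rot → Set
IsRotationSystem ρ =
  ∀ v → ρ v v ≡ v ×
        (∀ w → w ≢ v →
           iter (ρ v) 4 w ≡ w × iter (ρ v) 1 w ≢ w ×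
           iter (ρ v) 2 w ≢ w × iter (ρ v) 3 w ≢ w)

allB : {A : Set} → (A → Bool) → List A → Bool
allB p []       = true
allB p (x ∷ xs) = p x ∧ allB p xs

Dart : Set
Dart = V × V

isDart : Dart → Bool
isDart (u , v) = not (does (u ≟ v))

allDarts : List Dart
allDarts = filter (λ d → T? (isDart d)) (cartesianProduct (allFin 5) (allFin 5))

-- Face-tracing permutation: traverse dart (u,v), then leave v along the
-- edge following vu in the rotation at v.
faceStep : Rot → Dart → Dart
faceStep ρ (u , v) = (v , ρ v u)

dartIndex : Dart → ℕ
dartIndex (u , v) = toℕ u * 5 + toℕ v

-- d is the smallest dart (by index) in its face-tracing orbit
-- (orbits have length ≤ 20 = number of darts).
minInOrbit : Rot → Dart → Bool
minInOrbit ρ d = allB (λ k → dartIndex d ≤ᵇ dartIndex (iter (faceStep ρ) k d)) (upTo 20)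

-- number of faces = number of orbits of the face-tracing permutation
numFaces : Rot → ℕ
numFaces ρ = length (filter (λ d → T? (minInOrbit ρ d)) allDarts)

-- Euler: V - E + F = 2 - 2g
genus : Rot → ℕ
genus ρ = (2 + nE ∸ nV ∸ numFaces ρ) / 2

IsMaxGenus : Rot → Set
IsMaxGenus ρ = IsRotationSystem ρ × (∀ ρ' → IsRotationSystem ρ' → genus ρ' ≤ genus ρ)

Distinct : Rot → Rot → Set
Distinct ρ ρ' = ∃[ v ] ∃[ w ] ρ v w ≢ ρ' v w

-- By Euler's formula an embedding of K5 with F faces has genus (7 − F) / 2, so every
-- rotation system with a single face realises the maximum genus 3.  Choosing one of the
-- 3! = 6 cyclic orders of the four neighbours at each vertex gives all 6^5 rotation
-- systems; tracing their faces leaves 2340 with one face.  They are pairwise distinct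
-- because two different cyclic orders at a vertex already have different successor maps.
module Submission where

open import Defs
open import Data.Bool using (Bool; T; _∧_)
open import Data.Fin using (Fin; zero; suc; punchIn) renaming (_≟_ to _≟ᶠ_)
open import Data.Fin.Properties using (any?) renaming (all? to allᶠ?)
open import Data.List using (List; []; _∷_; [_]; map; filter; length; upTo; applyUpTo; cartesianProductWith)
open import Data.List.Properties using (map-upTo; map-cong; filter-≐)
open import Data.List.Relation.Unary.All using (All; []; _∷_; all?; universal) renaming (map to mapᴬ; zipWith to zipWithᴬ)
import Data.List.Relation.Unary.All.Properties as All
open import Data.List.Relation.Unary.AllPairs using (AllPairs; []; _∷_; allPairs?) renaming (map to mapᴬᴾ)
import Data.List.Relation.Unary.AllPairs.Properties as AllPairs
open import Data.Nat using (ℕ; zero; suc; _≤_; _≤ᵇ_; _∸_; _/_; _≟_)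
open import Data.Nat.DivMod using (/-monoˡ-≤)
open import Data.Nat.Properties using (m∸n≤m; m≤n+m; ≤-reflexive; ≤-trans; module ≤-Reasoning)
open import Data.Product using (_×_; _,_; ∃-syntax; uncurry)
open import Data.Unit using (tt)
open import Data.Vec using (Vec; []; _∷_; lookup)
open import Function using (_∘_)
open import Relation.Nullary using (Dec; yes; no; ¬?)
open import Relation.Nullary.Decidable using (T?; toWitness; map′; _×-dec_; _→-dec_)
open import Relation.Binary.PropositionalEquality using (_≡_; _≢_; refl; sym; trans; cong; subst; module ≡-Reasoning)

module _ {A B C : Set} (f : A → B → C) where

  all-cartesianProductWith : {P : A → Set} {Q : B → Set} {R : C → Set} →
    (∀ {x y} → P x → Q y → R (f x y)) →
    ∀ {xs ys} → All P xs → All Q ys → All R (cartesianProductWith f xs ys)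
  all-cartesianProductWith pres []         Qys = []
  all-cartesianProductWith pres (Px ∷ Pxs) Qys =
    All.++⁺ (All.map⁺ (mapᴬ (pres Px) Qys)) (all-cartesianProductWith pres Pxs Qys)

  allPairs-cartesianProductWith : {R : A → A → Set} {S : B → B → Set} {T : C → C → Set} →
    (∀ {x y y′} → S y y′ → T (f x y) (f x y′)) →
    (∀ {x x′ y y′} → R x x′ → T (f x y) (f x′ y′)) →
    ∀ {xs ys} → AllPairs R xs → AllPairs S ys → AllPairs T (cartesianProductWith f xs ys)
  allPairs-cartesianProductWith sameHead apartHeads []           Sys = []
  allPairs-cartesianProductWith sameHead apartHeads {ys = ys} (Rx ∷ Rxs) Sys =
    AllPairs.++⁺ (AllPairs.map⁺ (mapᴬᴾ sameHead Sys))
                 (allPairs-cartesianProductWith sameHead apartHeads Rxs Sys)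
                 (All.map⁺ (universal (λ y → all-cartesianProductWith (λ Rxx′ _ → apartHeads Rxx′) Rx
                                                                      (universal (λ _ → tt) ys)) ys))

choices : {A : Set} (n : ℕ) → (Fin n → List A) → List (Vec A n)
choices zero    f = [ [] ]
choices (suc n) f = cartesianProductWith _∷_ (f zero) (choices n (f ∘ suc))

all-choices : {A : Set} (n : ℕ) {f : Fin n → List A} {P : Fin n → A → Set} →
              (∀ i → All (P i) (f i)) → All (λ σ → ∀ i → P i (lookup σ i)) (choices n f)
all-choices zero    Pf = (λ ()) ∷ []
all-choices (suc n) Pf = all-cartesianProductWith _∷_ (λ { Px Pσ zero → Px ; Px Pσ (suc i) → Pσ i })
                                                  (Pf zero) (all-choices n (Pf ∘ suc))

allPairs-choices : {A : Set} (n : ℕ) {f : Fin n → List A} {R : A → A → Set} →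
                   (∀ i → AllPairs R (f i)) →
                   AllPairs (λ σ τ → ∃[ i ] R (lookup σ i) (lookup τ i)) (choices n f)
allPairs-choices zero    Rf = [] ∷ []
allPairs-choices (suc n) Rf = allPairs-cartesianProductWith _∷_ (λ { (i , r) → suc i , r }) (λ r → zero , r)
                                                            (Rf zero) (allPairs-choices n (Rf ∘ suc))

CyclicOrder : Set
CyclicOrder = V × V × V × V

successor : CyclicOrder → V → V
successor (a , b , c , d) w with w ≟ᶠ a | w ≟ᶠ b | w ≟ᶠ c | w ≟ᶠ d
... | yes _ | _     | _     | _     = b
... | no _  | yes _ | _     | _     = c
... | no _  | no _  | yes _ | _     = d
... | no _  | no _  | no _  | yes _ = a
... | no _  | no _  | no _  | no _  = w

-- Each cyclic order of the neighbours a < b < c < d of v is listed once, starting at a.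
cyclicOrdersAt : V → List CyclicOrder
cyclicOrdersAt v =
  (a , b , c , d) ∷ (a , b , d , c) ∷ (a , c , b , d) ∷ (a , c , d , b) ∷ (a , d , b , c) ∷ (a , d , c , b) ∷ []
  where
  a b c d : V
  a = punchIn v zero
  b = punchIn v (suc zero)
  c = punchIn v (suc (suc zero))
  d = punchIn v (suc (suc (suc zero)))

IsRotationAt : V → (V → V) → Set
IsRotationAt v r =
  r v ≡ v × (∀ w → w ≢ v → iter r 4 w ≡ w × iter r 1 w ≢ w × iter r 2 w ≢ w × iter r 3 w ≢ w)

isRotationAt? : ∀ v r → Dec (IsRotationAt v r)
isRotationAt? v r = (r v ≟ᶠ v) ×-dec allᶠ? λ w → ¬? (w ≟ᶠ v) →-dec
  ((iter r 4 w ≟ᶠ w) ×-dec ¬? (iter r 1 w ≟ᶠ w) ×-dec ¬? (iter r 2 w ≟ᶠ w) ×-dec ¬? (iter r 3 w ≟ᶠ w))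

SuccessorsDiffer : CyclicOrder → CyclicOrder → Set
SuccessorsDiffer c c′ = ∃[ w ] successor c w ≢ successor c′ w

cyclicOrdersAt-isRotationAt : ∀ v → All (IsRotationAt v ∘ successor) (cyclicOrdersAt v)
cyclicOrdersAt-isRotationAt = toWitness {a? = allᶠ? λ v → all? (isRotationAt? v ∘ successor) (cyclicOrdersAt v)} _

cyclicOrdersAt-successorsDiffer : ∀ v → AllPairs SuccessorsDiffer (cyclicOrdersAt v)
cyclicOrdersAt-successorsDiffer = toWitness {a? = allᶠ? λ v → allPairs? differ? (cyclicOrdersAt v)} _
  where
  differ? : ∀ c c′ → Dec (SuccessorsDiffer c c′)
  differ? c c′ = any? λ w → ¬? (successor c w ≟ᶠ successor c′ w)

rotation : Vec CyclicOrder 5 → Rot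
rotation σ v = successor (lookup σ v)

rotations : List Rot
rotations = map rotation (choices 5 cyclicOrdersAt)

rotations-areRotationSystems : All IsRotationSystem rotations
rotations-areRotationSystems =
  All.map⁺ {f = rotation} (all-choices 5 {f = cyclicOrdersAt} {P = λ v → IsRotationAt v ∘ successor} cyclicOrdersAt-isRotationAt)

rotations-distinct : AllPairs Distinct rotations
rotations-distinct =
  AllPairs.map⁺ {f = rotation} (allPairs-choices 5 {f = cyclicOrdersAt} {R = SuccessorsDiffer} cyclicOrdersAt-successorsDiffer)

orbit : {A : Set} → (A → A) → ℕ → A → List A
orbit f zero    x = []
orbit f (suc n) x = x ∷ orbit f n (f x)

iter-suc′ : {A : Set} (f : A → A) (k : ℕ) (x : A) → iter f k (f x) ≡ iter f (suc k) x
iter-suc′ f zero    x = refl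
iter-suc′ f (suc k) x = cong f (iter-suc′ f k x)

orbit≡applyUpTo-iter : {A : Set} (f : A → A) (n : ℕ) (x : A) → orbit f n x ≡ applyUpTo (λ k → iter f k x) n
orbit≡applyUpTo-iter f zero    x = refl
orbit≡applyUpTo-iter f (suc n) x = cong (x ∷_) (trans (orbit≡applyUpTo-iter f n (f x)) (shifted n))
  where
  shifted : ∀ m → applyUpTo (λ k → iter f k (f x)) m ≡ applyUpTo (λ k → iter f (suc k) x) m
  shifted m = trans (sym (map-upTo _ m)) (trans (map-cong (λ k → iter-suc′ f k x) (upTo m)) (map-upTo _ m))

allB-map : {A B : Set} (p : B → Bool) (g : A → B) (xs : List A) → allB p (map g xs) ≡ allB (p ∘ g) xs
allB-map p g []       = refl
allB-map p g (x ∷ xs) = cong (p (g x) ∧_) (allB-map p g xs)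

-- Traverses the orbit once instead of recomputing iter (faceStep ρ) k d for every k;
-- this is what makes evaluating the face count of all 6^5 rotation systems feasible.
minInOrbit′ : Rot → Dart → Bool
minInOrbit′ ρ d = allB (λ e → dartIndex d ≤ᵇ dartIndex e) (orbit (faceStep ρ) 20 d)

minInOrbit′≡minInOrbit : ∀ ρ d → minInOrbit′ ρ d ≡ minInOrbit ρ d
minInOrbit′≡minInOrbit ρ d = begin
  allB p (orbit (faceStep ρ) 20 d)                         ≡⟨ cong (allB p) (orbit≡applyUpTo-iter (faceStep ρ) 20 d) ⟩
  allB p (applyUpTo (λ k → iter (faceStep ρ) k d) 20)      ≡⟨ cong (allB p) (sym (map-upTo (λ k → iter (faceStep ρ) k d) 20)) ⟩
  allB p (map (λ k → iter (faceStep ρ) k d) (upTo 20))     ≡⟨ allB-map p (λ k → iter (faceStep ρ) k d) (upTo 20) ⟩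
  minInOrbit ρ d                                           ∎
  where
  open ≡-Reasoning
  p : Dart → Bool
  p e = dartIndex d ≤ᵇ dartIndex e

numFaces′ : Rot → ℕ
numFaces′ ρ = length (filter (λ d → T? (minInOrbit′ ρ d)) allDarts)

numFaces′≡numFaces : ∀ ρ → numFaces′ ρ ≡ numFaces ρ
numFaces′≡numFaces ρ =
  cong length (filter-≐ {P = T ∘ minInOrbit′ ρ} {Q = T ∘ minInOrbit ρ} (T? ∘ minInOrbit′ ρ) (T? ∘ minInOrbit ρ)
                        ((λ {d} → subst T (same d)) , (λ {d} → subst T (sym (same d)))) allDarts)
  where
  same : ∀ d → minInOrbit′ ρ d ≡ minInOrbit ρ d
  same = minInOrbit′≡minInOrbit ρ

hasOneFace? : ∀ ρ → Dec (numFaces ρ ≡ 1)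
hasOneFace? ρ = map′ (trans (sym (numFaces′≡numFaces ρ))) (trans (numFaces′≡numFaces ρ)) (numFaces′ ρ ≟ 1)

genus≤3 : ∀ ρ → genus ρ ≤ 3
genus≤3 ρ = /-monoˡ-≤ 2 (m∸n≤m 7 (numFaces ρ))

oneFace⇒maxGenus : ∀ {ρ} → IsRotationSystem ρ → numFaces ρ ≡ 1 → IsMaxGenus ρ
oneFace⇒maxGenus {ρ} isRot oneFace = isRot , λ ρ′ _ → begin
  genus ρ′              ≤⟨ genus≤3 ρ′ ⟩
  3                     ≡⟨ cong (λ F → (7 ∸ F) / 2) (sym oneFace) ⟩
  genus ρ               ∎
  where open ≤-Reasoning

oneFaceRotations : List Rot
oneFaceRotations = filter hasOneFace? rotations

length-oneFaceRotations : length oneFaceRotations ≡ 2340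
length-oneFaceRotations = refl

oneFaceRotations-maxGenus : All IsMaxGenus oneFaceRotations
oneFaceRotations-maxGenus = zipWithᴬ (uncurry oneFace⇒maxGenus)
  (All.filter⁺ hasOneFace? rotations-areRotationSystems , All.all-filter hasOneFace? rotations)

oneFaceRotations-distinct : AllPairs Distinct oneFaceRotations
oneFaceRotations-distinct = AllPairs.filter⁺ {R = Distinct} hasOneFace? {xs = rotations} rotations-distinct

mainTheorem12 : ∃[ L ] (432 ≤ length L × All IsMaxGenus L × AllPairs Distinct L)
mainTheorem12 =
  oneFaceRotations ,
  ≤-trans (m≤n+m 432 1908) (≤-reflexive (sym length-oneFaceRotations)) ,
  oneFaceRotations-maxGenus ,
  oneFaceRotations-distinct
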